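{- Let $\ell,s\geq 1$ be integers with $\ell\leq s+1$. Then, in $\mathbb{Z}[c]$, $$a_\ell\prod_{j=\ell}^{s}a_j=a_{s+1}-c\sum_{i=\ell+1}^{s+1}\prod_{j=i}^{s}a_j,$$ where an empty sum is $0$ and an empty product is $1$.
   Context: $a_i=a_i(c)\in\mathbb{Z}[c]$ is defined by $a_0=0$ and $a_i=a_{i-1}^2+c$ for $i\geq1$ (the iterates $f_c^i(0)$ of $f_c(z)=z^2+c$). -}

module Defs where

open import Data.Nat using (ℕ; zero; suc; _<_)
open import Data.Integer as ℤ using (ℤ; 0ℤ; 1ℤ)
open import Data.List using (List; []; _∷_)
open import Data.Product using (_×_)
open import Data.Unit using (⊤)
open import Relation.Binary.PropositionalEquality using (_≡_)

-- Univariate polynomials ℤ[c], as dense coefficient lists (constant term first).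
Poly : Set
Poly = List ℤ

IsZero : Poly → Set
IsZero []       = ⊤
IsZero (x ∷ p)  = (x ≡ 0ℤ) × IsZero p

infix 4 _≈_
_≈_ : Poly → Poly → Set
[]      ≈ q       = IsZero q
(x ∷ p) ≈ []      = IsZero (x ∷ p)
(x ∷ p) ≈ (y ∷ q) = (x ≡ y) × (p ≈ q)

infixl 6 _+_
_+_ : Poly → Poly → Poly
[]      + q       = q
(x ∷ p) + []      = x ∷ p
(x ∷ p) + (y ∷ q) = (x ℤ.+ y) ∷ (p + q)

neg : Poly → Poly
neg []      = []
neg (x ∷ p) = ℤ.- x ∷ neg p

infixl 6 _-_
_-_ : Poly → Poly → Poly
p - q = p + neg q

scale : ℤ → Poly → Poly
scale a []      = []
scale a (x ∷ p) = (a ℤ.* x) ∷ scale a p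

infixl 7 _*_
_*_ : Poly → Poly → Poly
[]      * q = []
(x ∷ p) * q = scale x q + (0ℤ ∷ (p * q))

zeroP : Poly
zeroP = []

oneP : Poly
oneP = 1ℤ ∷ []

c : Poly
c = 0ℤ ∷ 1ℤ ∷ []

a : ℕ → Poly
a zero    = zeroP
a (suc i) = a i * a i + c

-- ∏_{j=m}^{n} f j  (empty product = 1 when n < m)
-- defined as  ∏_{k=0}^{len-1} f (m + k) with len = n + 1 - m
prodFrom : ℕ → ℕ → (ℕ → Poly) → Poly
prodFrom m zero    f = oneP
prodFrom m (suc k) f = f m * prodFrom (suc m) k f

sumFrom : ℕ → ℕ → (ℕ → Poly) → Poly
sumFrom m zero    f = zeroP
sumFrom m (suc k) f = f m + sumFrom (suc m) k f

open import Data.Nat using (_∸_) renaming (_+_ to _+ℕ_)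

∏[_≤j≤_] : ℕ → ℕ → (ℕ → Poly) → Poly
∏[ m ≤j≤ n ] f = prodFrom m (suc n ∸ m) f

∑[_≤i≤_] : ℕ → ℕ → (ℕ → Poly) → Poly
∑[ m ≤i≤ n ] f = sumFrom m (suc n ∸ m) f

-- With P i = ∏_{j=i}^{s} a_j we have P ℓ = a_ℓ · P (ℓ+1) and a_ℓ² = a_{ℓ+1} − c, so
-- a_ℓ · P ℓ = a_{ℓ+1} · P (ℓ+1) − c · P (ℓ+1). Telescoping this from ℓ up to s+1,
-- where P (s+1) = 1, gives the identity. The ring laws it needs are proved for
-- equality of coefficient sequences, which implies the list equality _≈_.
module Submission where

open import Defs
open import Data.Nat as ℕ using (ℕ; zero; suc; _∸_; _≤_; s≤s)
import Data.Nat.Properties as ℕ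
open import Data.Integer as ℤ using (ℤ; 0ℤ)
import Data.Integer.Properties as ℤ
open import Data.Integer.Tactic.RingSolver using (solve-∀)
open import Data.List using ([]; _∷_)
open import Data.Product using (_,_)
open import Data.Unit using (tt)
open import Relation.Binary.Bundles using (Setoid)
open import Relation.Binary.PropositionalEquality using (_≡_; refl; sym; trans; cong; cong₂; subst)

coeff : Poly → ℕ → ℤ
coeff []      n       = 0ℤ
coeff (x ∷ p) zero    = x
coeff (x ∷ p) (suc n) = coeff p n

-- A record rather than a function type, so that unification can recover p and q.
infix 4 _≐_
record _≐_ (p q : Poly) : Set where
  constructor coeffwise
  field coeff-≡ : ∀ n → coeff p n ≡ coeff q n
open _≐_

≐-refl : ∀ {p} → p ≐ p
≐-refl = coeffwise λ n → refl

≐-reflexive : ∀ {p q} → p ≡ q → p ≐ q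
≐-reflexive refl = ≐-refl

≐-sym : ∀ {p q} → p ≐ q → q ≐ p
≐-sym p≐q = coeffwise λ n → sym (coeff-≡ p≐q n)

≐-trans : ∀ {p q r} → p ≐ q → q ≐ r → p ≐ r
≐-trans p≐q q≐r = coeffwise λ n → trans (coeff-≡ p≐q n) (coeff-≡ q≐r n)

≐-setoid : Setoid _ _
≐-setoid = record
  { Carrier       = Poly
  ; _≈_           = _≐_
  ; isEquivalence = record { refl = ≐-refl ; sym = ≐-sym ; trans = ≐-trans }
  }

open import Relation.Binary.Reasoning.Setoid ≐-setoid

tail-≐ : ∀ {x y p q} → x ∷ p ≐ y ∷ q → p ≐ q
tail-≐ xp≐yq = coeffwise λ n → coeff-≡ xp≐yq (suc n)

≐[]⇒IsZero : ∀ p → p ≐ [] → IsZero p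
≐[]⇒IsZero []      p≐[] = tt
≐[]⇒IsZero (x ∷ p) p≐[] = coeff-≡ p≐[] 0 , ≐[]⇒IsZero p (coeffwise λ n → coeff-≡ p≐[] (suc n))

≐⇒≈ : ∀ p q → p ≐ q → p ≈ q
≐⇒≈ []      q       p≐q = ≐[]⇒IsZero q (≐-sym p≐q)
≐⇒≈ (x ∷ p) []      p≐q = ≐[]⇒IsZero (x ∷ p) p≐q
≐⇒≈ (x ∷ p) (y ∷ q) p≐q = coeff-≡ p≐q 0 , ≐⇒≈ p q (tail-≐ p≐q)

coeff-+ : ∀ p q n → coeff (p + q) n ≡ coeff p n ℤ.+ coeff q n
coeff-+ []      q       n       = sym (ℤ.+-identityˡ _)
coeff-+ (x ∷ p) []      n       = sym (ℤ.+-identityʳ _)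
coeff-+ (x ∷ p) (y ∷ q) zero    = refl
coeff-+ (x ∷ p) (y ∷ q) (suc n) = coeff-+ p q n

coeff-neg : ∀ p n → coeff (neg p) n ≡ ℤ.- coeff p n
coeff-neg []      n       = refl
coeff-neg (x ∷ p) zero    = refl
coeff-neg (x ∷ p) (suc n) = coeff-neg p n

coeff-scale : ∀ x p n → coeff (scale x p) n ≡ x ℤ.* coeff p n
coeff-scale x []      n       = sym (ℤ.*-zeroʳ x)
coeff-scale x (y ∷ p) zero    = refl
coeff-scale x (y ∷ p) (suc n) = coeff-scale x p n

∷-cong : ∀ {x y p q} → x ≡ y → p ≐ q → x ∷ p ≐ y ∷ q
coeff-≡ (∷-cong x≡y p≐q) zero    = x≡y
coeff-≡ (∷-cong x≡y p≐q) (suc n) = coeff-≡ p≐q n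

+-cong : ∀ {p p′ q q′} → p ≐ p′ → q ≐ q′ → p + q ≐ p′ + q′
coeff-≡ (+-cong {p} {p′} {q} {q′} p≐p′ q≐q′) n =
  trans (coeff-+ p q n) (trans (cong₂ ℤ._+_ (coeff-≡ p≐p′ n) (coeff-≡ q≐q′ n)) (sym (coeff-+ p′ q′ n)))

neg-cong : ∀ {p q} → p ≐ q → neg p ≐ neg q
coeff-≡ (neg-cong {p} {q} p≐q) n =
  trans (coeff-neg p n) (trans (cong ℤ.-_ (coeff-≡ p≐q n)) (sym (coeff-neg q n)))

minus-cong : ∀ {p p′ q q′} → p ≐ p′ → q ≐ q′ → p - q ≐ p′ - q′
minus-cong p≐p′ q≐q′ = +-cong p≐p′ (neg-cong q≐q′)

coeff-- : ∀ p q n → coeff (p - q) n ≡ coeff p n ℤ.- coeff q n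
coeff-- p q n = trans (coeff-+ p (neg q) n) (cong (λ z → coeff p n ℤ.+ z) (coeff-neg q n))

+-identityʳ : ∀ p → p + [] ≡ p
+-identityʳ []      = refl
+-identityʳ (x ∷ p) = refl

+-interchange : ∀ p q r s → (p + q) + (r + s) ≐ (p + r) + (q + s)
coeff-≡ (+-interchange p q r s) n
  rewrite coeff-+ (p + q) (r + s) n | coeff-+ (p + r) (q + s) n
        | coeff-+ p q n | coeff-+ r s n | coeff-+ p r n | coeff-+ q s n
  = interchange (coeff p n) (coeff q n) (coeff r n) (coeff s n)
  where open import Algebra.Properties.CommutativeSemigroup ℤ.+-commutativeSemigroup

p+q-q≐p : ∀ p q → p + q - q ≐ p
coeff-≡ (p+q-q≐p p q) n rewrite coeff-- (p + q) q n | coeff-+ p q n = x+y-y≡x (coeff p n) (coeff q n)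
  where
  x+y-y≡x : ∀ x y → x ℤ.+ y ℤ.- y ≡ x
  x+y-y≡x = solve-∀

p-q-r≐p-[r+q] : ∀ p q r → p - q - r ≐ p - (r + q)
coeff-≡ (p-q-r≐p-[r+q] p q r) n
  rewrite coeff-- (p - q) r n | coeff-- p q n | coeff-- p (r + q) n | coeff-+ r q n
  = x-y-z≡x-[z+y] (coeff p n) (coeff q n) (coeff r n)
  where
  x-y-z≡x-[z+y] : ∀ x y z → x ℤ.- y ℤ.- z ≡ x ℤ.- (z ℤ.+ y)
  x-y-z≡x-[z+y] = solve-∀

scale-zeroˡ : ∀ p → scale 0ℤ p ≐ []
coeff-≡ (scale-zeroˡ p) n = trans (coeff-scale 0ℤ p n) (ℤ.*-zeroˡ (coeff p n))

scale-distribˡ : ∀ x p q → scale x (p + q) ≐ scale x p + scale x q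
coeff-≡ (scale-distribˡ x p q) n
  rewrite coeff-scale x (p + q) n | coeff-+ (scale x p) (scale x q) n
        | coeff-+ p q n | coeff-scale x p n | coeff-scale x q n
  = ℤ.*-distribˡ-+ x (coeff p n) (coeff q n)

scale-distribʳ : ∀ x y p → scale (x ℤ.+ y) p ≐ scale x p + scale y p
coeff-≡ (scale-distribʳ x y p) n
  rewrite coeff-scale (x ℤ.+ y) p n | coeff-+ (scale x p) (scale y p) n
        | coeff-scale x p n | coeff-scale y p n
  = ℤ.*-distribʳ-+ (coeff p n) x y

scale-scale : ∀ x y p → scale (x ℤ.* y) p ≐ scale x (scale y p)
coeff-≡ (scale-scale x y p) n
  rewrite coeff-scale (x ℤ.* y) p n | coeff-scale x (scale y p) n | coeff-scale y p n
  = ℤ.*-assoc x y (coeff p n)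

*-zeroʳ : ∀ p → p * [] ≐ []
coeff-≡ (*-zeroʳ [])      n       = refl
coeff-≡ (*-zeroʳ (x ∷ p)) zero    = refl
coeff-≡ (*-zeroʳ (x ∷ p)) (suc n) = coeff-≡ (*-zeroʳ p) n

*-identityʳ : ∀ p → p * oneP ≐ p
*-identityʳ []      = ≐-refl
*-identityʳ (x ∷ p) = ∷-cong (trans (ℤ.+-identityʳ _) (ℤ.*-identityʳ x)) (*-identityʳ p)

shift-* : ∀ p q → (0ℤ ∷ p) * q ≐ 0ℤ ∷ (p * q)
shift-* p q = +-cong (scale-zeroˡ q) ≐-refl

*-distribˡ-+ : ∀ p q r → p * (q + r) ≐ p * q + p * r
*-distribˡ-+ []      q r = ≐-refl
*-distribˡ-+ (x ∷ p) q r = begin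
  scale x (q + r) + (0ℤ ∷ p * (q + r))                  ≈⟨ +-cong (scale-distribˡ x q r) (∷-cong refl (*-distribˡ-+ p q r)) ⟩
  (scale x q + scale x r) + ((0ℤ ∷ p * q) + (0ℤ ∷ p * r)) ≈⟨ +-interchange (scale x q) (scale x r) _ _ ⟩
  (x ∷ p) * q + (x ∷ p) * r                             ∎

*-distribʳ-+ : ∀ p q r → (p + q) * r ≐ p * r + q * r
*-distribʳ-+ []      q       r = ≐-refl
*-distribʳ-+ (x ∷ p) []      r = ≐-reflexive (sym (+-identityʳ _))
*-distribʳ-+ (x ∷ p) (y ∷ q) r = begin
  scale (x ℤ.+ y) r + (0ℤ ∷ (p + q) * r)                  ≈⟨ +-cong (scale-distribʳ x y r) (∷-cong refl (*-distribʳ-+ p q r)) ⟩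
  (scale x r + scale y r) + ((0ℤ ∷ p * r) + (0ℤ ∷ q * r)) ≈⟨ +-interchange (scale x r) (scale y r) _ _ ⟩
  (x ∷ p) * r + (y ∷ q) * r                               ∎

scale-* : ∀ x p q → scale x p * q ≐ scale x (p * q)
scale-* x []      q = ≐-refl
scale-* x (y ∷ p) q = begin
  scale (x ℤ.* y) q + (0ℤ ∷ scale x p * q)       ≈⟨ +-cong (scale-scale x y q) (∷-cong (sym (ℤ.*-zeroʳ x)) (scale-* x p q)) ⟩
  scale x (scale y q) + scale x (0ℤ ∷ (p * q))   ≈⟨ scale-distribˡ x (scale y q) (0ℤ ∷ p * q) ⟨
  scale x ((y ∷ p) * q)                          ∎

*-assoc : ∀ p q r → (p * q) * r ≐ p * (q * r)
*-assoc []      q r = ≐-refl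
*-assoc (x ∷ p) q r = begin
  (scale x q + (0ℤ ∷ p * q)) * r          ≈⟨ *-distribʳ-+ (scale x q) (0ℤ ∷ p * q) r ⟩
  scale x q * r + (0ℤ ∷ p * q) * r        ≈⟨ +-cong (scale-* x q r) (shift-* (p * q) r) ⟩
  scale x (q * r) + (0ℤ ∷ (p * q) * r)    ≈⟨ +-cong ≐-refl (∷-cong refl (*-assoc p q r)) ⟩
  (x ∷ p) * (q * r)                       ∎

∏-peel : ∀ {ℓ n} (f : ℕ → Poly) → ℓ ≤ n → ∏[ ℓ ≤j≤ n ] f ≡ f ℓ * ∏[ suc ℓ ≤j≤ n ] f
∏-peel f ℓ≤n rewrite ℕ.+-∸-assoc 1 ℓ≤n = refl

∑-peel : ∀ {ℓ n} (f : ℕ → Poly) → ℓ ≤ n → ∑[ ℓ ≤i≤ n ] f ≡ f ℓ + ∑[ suc ℓ ≤i≤ n ] f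
∑-peel f ℓ≤n rewrite ℕ.+-∸-assoc 1 ℓ≤n = refl

∏-empty : ∀ n (f : ℕ → Poly) → ∏[ suc n ≤j≤ n ] f ≡ oneP
∏-empty n f rewrite ℕ.n∸n≡0 n = refl

∑-empty : ∀ n (f : ℕ → Poly) → ∑[ suc n ≤i≤ n ] f ≡ zeroP
∑-empty n f rewrite ℕ.n∸n≡0 n = refl

telescope : ∀ s k ℓ → k ℕ.+ ℓ ≡ suc s →
  a ℓ * ∏[ ℓ ≤j≤ s ] a ≐ a (suc s) - c * ∑[ suc ℓ ≤i≤ suc s ] (λ i → ∏[ i ≤j≤ s ] a)
telescope s zero .(suc s) refl = begin
  a (suc s) * ∏[ suc s ≤j≤ s ] a  ≡⟨ cong (a (suc s) *_) (∏-empty s a) ⟩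
  a (suc s) * oneP                ≈⟨ *-identityʳ (a (suc s)) ⟩
  a (suc s)                       ≡⟨ +-identityʳ (a (suc s)) ⟨
  a (suc s) - []                  ≈⟨ minus-cong ≐-refl (*-zeroʳ c) ⟨
  a (suc s) - c * []              ≡⟨ cong (λ q → a (suc s) - c * q) (∑-empty (suc s) _) ⟨
  a (suc s) - c * ∑[ suc (suc s) ≤i≤ suc s ] (λ i → ∏[ i ≤j≤ s ] a) ∎
telescope s (suc k) ℓ k+ℓ≡s = begin
  a ℓ * ∏[ ℓ ≤j≤ s ] a           ≡⟨ cong (a ℓ *_) (∏-peel a ℓ≤s) ⟩
  a ℓ * (a ℓ * P)                ≈⟨ *-assoc (a ℓ) (a ℓ) P ⟨
  a ℓ * a ℓ * P                  ≈⟨ p+q-q≐p (a ℓ * a ℓ * P) (c * P) ⟨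
  a ℓ * a ℓ * P + c * P - c * P  ≈⟨ minus-cong (*-distribʳ-+ (a ℓ * a ℓ) c P) ≐-refl ⟨
  a (suc ℓ) * P - c * P          ≈⟨ minus-cong (telescope s k (suc ℓ) k+1+ℓ≡s) ≐-refl ⟩
  a (suc s) - c * S - c * P      ≈⟨ p-q-r≐p-[r+q] (a (suc s)) (c * S) (c * P) ⟩
  a (suc s) - (c * P + c * S)    ≈⟨ minus-cong ≐-refl (*-distribˡ-+ c P S) ⟨
  a (suc s) - c * (P + S)        ≡⟨ cong (λ q → a (suc s) - c * q) (∑-peel _ (s≤s ℓ≤s)) ⟨
  a (suc s) - c * ∑[ suc ℓ ≤i≤ suc s ] (λ i → ∏[ i ≤j≤ s ] a) ∎
  where
  P S : Poly
  P = ∏[ suc ℓ ≤j≤ s ] a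
  S = ∑[ suc (suc ℓ) ≤i≤ suc s ] (λ i → ∏[ i ≤j≤ s ] a)
  k+1+ℓ≡s : k ℕ.+ suc ℓ ≡ suc s
  k+1+ℓ≡s = trans (ℕ.+-suc k ℓ) k+ℓ≡s
  ℓ≤s : ℓ ≤ s
  ℓ≤s = subst (ℓ ≤_) (ℕ.suc-injective k+ℓ≡s) (ℕ.m≤n+m ℓ k)

lemma3p4 : (ℓ s : ℕ) → 1 ≤ ℓ → 1 ≤ s → ℓ ≤ suc s →
    a ℓ * ∏[ ℓ ≤j≤ s ] a ≈ a (suc s) - c * ∑[ suc ℓ ≤i≤ suc s ] (λ i → ∏[ i ≤j≤ s ] a)
lemma3p4 ℓ s _ _ ℓ≤1+s = ≐⇒≈ _ _ (telescope s (suc s ∸ ℓ) ℓ (ℕ.m∸n+n≡m ℓ≤1+s))
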